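{- Let $A$ be an $R$-algebra that is $p$-torsion free, $p$-adically separated, and with $A/pA$ reduced. For $m\ge0$ let $A_m=A\otimes_RR[p^{1/p^m}]$. Then each $A_m$ is $p$-torsion free, $p$-adically separated, and totally integrally closed in $A_m[1/p]$.
   Context: $p$ is an odd prime; $R$ is a complete discrete valuation ring with maximal ideal $pR$ and algebraically closed residue field. $p^{1/p^m}$ is a fixed $p^m$-th root of $p$ in an algebraic closure of $R[1/p]$, with $R[p^{1/p^m}]\cong R[z_m]/(z_m^{p^m}-p)$. A subring $A$ of a ring $B$ is totally integrally closed in $B$ if every $b\in B$ with $\{b^n:n\in\mathbb N\}$ contained in a finitely generated $A$-submodule of $B$ lies in $A$. -}

module Defs where

open import Level using (Level; _⊔_)
open import Algebra.Bundles using (CommutativeRing)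
open import Algebra.Morphism.Structures using (IsRingHomomorphism)
open import Data.Nat as ℕ using (ℕ; zero; suc)
open import Data.Fin using (Fin; toℕ) renaming (zero to fzero; suc to fsuc)
open import Data.Bool using (if_then_else_)
open import Data.Product using (Σ; ∃; _×_; _,_)
open import Data.Sum using (_⊎_)
open import Relation.Nullary using (¬_; does)

module RingNotions {c ℓ : Level} (S : CommutativeRing c ℓ) where
  open CommutativeRing S

  pow : Carrier → ℕ → Carrier
  pow x zero    = 1#
  pow x (suc n) = x * pow x n

  nat : ℕ → Carrier
  nat zero    = 0#
  nat (suc n) = 1# + nat n

  sumFin : ∀ {n} → (Fin n → Carrier) → Carrier
  sumFin {zero}  f = 0#
  sumFin {suc n} f = f fzero + sumFin (λ i → f (fsuc i))

  _∣ᵣ_ : Carrier → Carrier → Set (c ⊔ ℓ)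
  a ∣ᵣ b = ∃ λ y → b ≈ a * y

  IsUnit : Carrier → Set (c ⊔ ℓ)
  IsUnit x = ∃ λ u → x * u ≈ 1#

  PTorsionFree : ℕ → Set (c ⊔ ℓ)
  PTorsionFree p = ∀ x → nat p * x ≈ 0# → x ≈ 0#

  PSeparated : ℕ → Set (c ⊔ ℓ)
  PSeparated p = ∀ x → (∀ n → pow (nat p) n ∣ᵣ x) → x ≈ 0#

  ReducedModP : ℕ → Set (c ⊔ ℓ)
  ReducedModP p = ∀ x n → nat p ∣ᵣ pow x n → nat p ∣ᵣ x

  IsDVRWithUniformizer : ℕ → Set (c ⊔ ℓ)
  IsDVRWithUniformizer p =
    (¬ (1# ≈ 0#)) ×
    (∀ x y → x * y ≈ 0# → (x ≈ 0#) ⊎ (y ≈ 0#)) ×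
    (¬ (nat p ≈ 0#)) ×
    (¬ IsUnit (nat p)) ×
    (∀ x → ¬ (x ≈ 0#) → ∃ λ u → ∃ λ n → IsUnit u × (x ≈ u * pow (nat p) n))

  PComplete : ℕ → Set (c ⊔ ℓ)
  PComplete p =
    (x : ℕ → Carrier) →
    (∀ n → pow (nat p) n ∣ᵣ (x (suc n) - x n)) →
    ∃ λ y → ∀ n → pow (nat p) n ∣ᵣ (y - x n)

  -- the residue field S/pS is algebraically closed: every monic
  -- polynomial of positive degree over S has a root modulo p
  ResidueAlgClosed : ℕ → Set (c ⊔ ℓ)
  ResidueAlgClosed p =
    (d : ℕ) (a : Fin (suc d) → Carrier) →
    ∃ λ r → nat p ∣ᵣ (pow r (suc d) + sumFin (λ i → a i * pow r (toℕ i)))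

IsAlgebraMap : {r ℓr a ℓa : Level} (R : CommutativeRing r ℓr) (A : CommutativeRing a ℓa) →
               (CommutativeRing.Carrier R → CommutativeRing.Carrier A) → Set (r ⊔ ℓr ⊔ ℓa)
IsAlgebraMap R A f =
  IsRingHomomorphism (CommutativeRing.rawRing R) (CommutativeRing.rawRing A) f

-- A_m = A ⊗_R R[p^{1/p^m}] ≅ A[z]/(z^N - π), N = p^m, π = p in A,
-- realised as the free A-module with basis 1, z, …, z^(N-1).

module Adjoin {c ℓ : Level} (A : CommutativeRing c ℓ) (π : CommutativeRing.Carrier A) (N : ℕ) where
  open CommutativeRing A
  open RingNotions A

  Elt : Set c
  Elt = Fin N → Carrier

  _≈ₘ_ : Elt → Elt → Set ℓ
  f ≈ₘ g = ∀ i → f i ≈ g i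

  0ₘ : Elt
  0ₘ i = 0#

  1ₘ : Elt
  1ₘ i = if does (toℕ i ℕ.≟ 0) then 1# else 0#

  _+ₘ_ : Elt → Elt → Elt
  (f +ₘ g) i = f i + g i

  scale : Carrier → Elt → Elt
  scale a f i = a * f i

  -- multiplication in A[z]/(z^N - π)
  _*ₘ_ : Elt → Elt → Elt
  (f *ₘ g) k = sumFin λ i → sumFin λ j →
    if does (toℕ i ℕ.+ toℕ j ℕ.≟ toℕ k)
      then f i * g j
      else (if does (toℕ i ℕ.+ toℕ j ℕ.≟ toℕ k ℕ.+ N)
              then π * (f i * g j)
              else 0#)

  TorsionFreeₘ : Set (c ⊔ ℓ)
  TorsionFreeₘ = ∀ x → scale π x ≈ₘ 0ₘ → x ≈ₘ 0ₘ

  Separatedₘ : Set (c ⊔ ℓ)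
  Separatedₘ = ∀ x → (∀ n → ∃ λ y → x ≈ₘ scale (pow π n) y) → x ≈ₘ 0ₘ

  -- A_m[1/p]: pairs (b , k) standing for b / πᵏ
  Frac : Set c
  Frac = Elt × ℕ

  _≈ₗ_ : Frac → Frac → Set ℓ
  (b , k) ≈ₗ (b' , k') =
    ∃ λ j → scale (pow π (j ℕ.+ k')) b ≈ₘ scale (pow π (j ℕ.+ k)) b'

  ι : Elt → Frac
  ι b = (b , 0)

  0ₗ : Frac
  0ₗ = ι 0ₘ

  1ₗ : Frac
  1ₗ = ι 1ₘ

  _+ₗ_ : Frac → Frac → Frac
  (b , k) +ₗ (b' , k') = (scale (pow π k') b +ₘ scale (pow π k) b' , k ℕ.+ k')

  _*ₗ_ : Frac → Frac → Frac
  (b , k) *ₗ (b' , k') = (b *ₘ b' , k ℕ.+ k')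

  powₗ : Frac → ℕ → Frac
  powₗ x zero    = 1ₗ
  powₗ x (suc n) = x *ₗ powₗ x n

  sumₗ : ∀ {r} → (Fin r → Frac) → Frac
  sumₗ {zero}  f = 0ₗ
  sumₗ {suc r} f = f fzero +ₗ sumₗ (λ i → f (fsuc i))

  InSpan : ∀ {r} → (Fin r → Frac) → Frac → Set (c ⊔ ℓ)
  InSpan g x = ∃ λ (a : Fin _ → Elt) → x ≈ₗ sumₗ (λ i → ι (a i) *ₗ g i)

  TotallyIntClosedₘ : Set (c ⊔ ℓ)
  TotallyIntClosedₘ =
    ∀ (x : Frac) →
    (∃ λ r → ∃ λ (g : Fin r → Frac) → ∀ n → InSpan g (powₗ x n)) →
    ∃ λ (a : Elt) → x ≈ₗ ι a

module Submission where

-- Lemma 3.5.  Write N = pᵐ and π = p.  The ring A_m = A ⊗_R R[p^{1/N}] is realised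
-- (in Defs) as A[z]/(zᴺ − π), the free A-module on 1, z, …, zᴺ⁻¹.  Torsion freeness and separatedness
-- hold coefficientwise.  For total integral closedness, let x = b / πᵏ have all
-- powers in a finitely generated A_m-submodule of A_m[1/π], with common
-- denominator πᴷ; then πᴰ ∣ bⁿ whenever K + D = n k.  Giving πᵠ zⁱ the weight
-- i + q N, we show by induction on t that zᵗ ∣ b for t ≤ N k: the leading
-- coefficient a of b at weight t is multiplicative, so aⁿ is the leading coefficient
-- of bⁿ, and choosing n = N K + 1 makes πᴰ ∣ bⁿ force π ∣ aⁿ; as A/πA is reduced,
-- π ∣ a.

open import Defs
open import Level using (Level; _⊔_)
open import Algebra.Bundles using (CommutativeRing)
open import Data.Nat as ℕ using (ℕ; zero; suc; NonZero; _≤_; _<_; _^_; _<?_)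
import Data.Nat.Properties as ℕP
import Data.Nat.DivMod as DM
open import Data.Nat.Primality using (Prime; prime⇒nonZero)
open import Data.Nat.Solver using (module +-*-Solver)
open import Data.Fin using (Fin; toℕ; fromℕ<) renaming (zero to fzero; suc to fsuc)
import Data.Fin.Properties as FinP
open import Data.Product using (Σ; ∃; _×_; _,_; proj₁; proj₂)
open import Data.Sum using (_⊎_; inj₁; inj₂)
open import Data.Empty using (⊥-elim)
open import Function using (_∘_)
open import Relation.Nullary using (¬_; does; yes; no)
open import Relation.Nullary.Decidable using (dec-true; dec-false)
open import Relation.Binary.PropositionalEquality as ≡ using (_≡_; _≢_)

module PowerDivisibility {c ℓ : Level} (A : CommutativeRing c ℓ) (π : CommutativeRing.Carrier A) where
  open CommutativeRing A
  open RingNotions A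
  open import Relation.Binary.Reasoning.Setoid setoid
  open import Algebra.Solver.Ring.NaturalCoefficients.Default commutativeSemiring

  Π : ℕ → Carrier
  Π = pow π

  Π-+ : ∀ a b → Π (a ℕ.+ b) ≈ Π a * Π b
  Π-+ zero    b = sym (*-identityˡ _)
  Π-+ (suc a) b = trans (*-congˡ (Π-+ a b)) (sym (*-assoc _ _ _))

  ∣-0 : ∀ d → d ∣ᵣ 0#
  ∣-0 d = 0# , sym (zeroʳ d)

  ∣-+ : ∀ {d x y} → d ∣ᵣ x → d ∣ᵣ y → d ∣ᵣ (x + y)
  ∣-+ {d} (u , x≈du) (v , y≈dv) = u + v , trans (+-cong x≈du y≈dv) (sym (distribˡ d u v))

  Π⁰-∣ : ∀ x → Π 0 ∣ᵣ x
  Π⁰-∣ x = x , sym (*-identityˡ x)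

  Π-∣-mono : ∀ {a b x} → a ≤ b → Π b ∣ᵣ x → Π a ∣ᵣ x
  Π-∣-mono {a} a≤b (y , x≈Πby) with ℕP.m≤n⇒∃[o]m+o≡n a≤b
  ... | o , ≡.refl = Π o * y , trans x≈Πby (trans (*-congʳ (Π-+ a o)) (*-assoc _ _ _))

  Π-∣-* : ∀ a b {u v} → Π a ∣ᵣ u → Π b ∣ᵣ v → Π (a ℕ.+ b) ∣ᵣ (u * v)
  Π-∣-* a b {u} {v} (y , u≈) (z , v≈) = y * z , (begin
    u * v                  ≈⟨ *-cong u≈ v≈ ⟩
    (Π a * y) * (Π b * z)  ≈⟨ solve 4 (λ P Q y z → (P :* y) :* (Q :* z) := (P :* Q) :* (y :* z))
                                     refl (Π a) (Π b) y z ⟩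
    (Π a * Π b) * (y * z)  ≈⟨ *-congʳ (sym (Π-+ a b)) ⟩
    Π (a ℕ.+ b) * (y * z)  ∎)

  Π-∣-π* : ∀ a {u} → Π a ∣ᵣ u → Π (suc a) ∣ᵣ (π * u)
  Π-∣-π* a (y , u≈) = y , trans (*-congˡ u≈) (sym (*-assoc _ _ _))

  ∣-sumFin : ∀ {n d} (F : Fin n → Carrier) → (∀ i → d ∣ᵣ F i) → d ∣ᵣ sumFin F
  ∣-sumFin {zero}  {d} F d∣F = ∣-0 d
  ∣-sumFin {suc n}     F d∣F = ∣-+ (d∣F fzero) (∣-sumFin (F ∘ fsuc) (d∣F ∘ fsuc))

  Π-∣-suc : ∀ q {x a} → x ≈ Π q * a → π ∣ᵣ a → Π (suc q) ∣ᵣ x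
  Π-∣-suc q {x} {a} x≈Πqa (y , a≈πy) = y , (begin
    x              ≈⟨ x≈Πqa ⟩
    Π q * a        ≈⟨ *-congˡ a≈πy ⟩
    Π q * (π * y)  ≈⟨ solve 3 (λ P p y → P :* (p :* y) := (p :* P) :* y) refl (Π q) π y ⟩
    Π (suc q) * y  ∎)

  Congruent : Carrier → Carrier → Carrier → Set (c ⊔ ℓ)
  Congruent d u v = ∃ λ y → u ≈ v + d * y

  Congruent-≈ : ∀ {d u v} → u ≈ v → Congruent d u v
  Congruent-≈ {d} {u} {v} u≈v =
    0# , trans u≈v (trans (sym (+-identityʳ v)) (+-congˡ (sym (zeroʳ d))))

  Congruent-resp : ∀ {d u u' v v'} → u ≈ u' → v ≈ v' → Congruent d u v → Congruent d u' v'
  Congruent-resp u≈ v≈ (y , h) = y , trans (sym u≈) (trans h (+-congʳ v≈))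

  Congruent-+ : ∀ {d a a' b b'} → Congruent d a b → Congruent d a' b' →
                Congruent d (a + a') (b + b')
  Congruent-+ {d} {a} {a'} {b} {b'} (y , a≈) (y' , a'≈) = y + y' , (begin
    a + a'                       ≈⟨ +-cong a≈ a'≈ ⟩
    (b + d * y) + (b' + d * y')  ≈⟨ solve 5 (λ b b' d y y' → (b :+ d :* y) :+ (b' :+ d :* y')
                                               := (b :+ b') :+ d :* (y :+ y')) refl b b' d y y' ⟩
    (b + b') + d * (y + y')      ∎)

  ∣⇒Congruent-0 : ∀ {d u} → d ∣ᵣ u → Congruent d u 0#
  ∣⇒Congruent-0 (y , u≈) = y , trans u≈ (sym (+-identityˡ _))

  Congruent-sumFin : ∀ {n d} (F : Fin n → Carrier) (r : Fin n) (x : Carrier) →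
                     (∀ i → i ≢ r → d ∣ᵣ F i) → Congruent d (F r) x → Congruent d (sumFin F) x
  Congruent-sumFin {suc n} F fzero x others Fr≡x =
    Congruent-resp refl (+-identityʳ x)
      (Congruent-+ Fr≡x (∣⇒Congruent-0 (∣-sumFin (F ∘ fsuc) λ i → others (fsuc i) λ ())))
  Congruent-sumFin {suc n} F (fsuc r) x others Fr≡x =
    Congruent-resp refl (+-identityˡ x)
      (Congruent-+ (∣⇒Congruent-0 (others fzero λ ()))
        (Congruent-sumFin (F ∘ fsuc) r x (λ i i≢r → others (fsuc i) (i≢r ∘ FinP.suc-injective)) Fr≡x))

  Congruent-* : ∀ a b {u v x y} →
                Congruent (Π (suc a)) u (Π a * x) → Congruent (Π (suc b)) v (Π b * y) →
                Congruent (Π (suc (a ℕ.+ b))) (u * v) (Π (a ℕ.+ b) * (x * y))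
  Congruent-* a b {u} {v} {x} {y} (s , u≈) (t , v≈) = (x * t + s * y + π * (s * t)) , (begin
    u * v
      ≈⟨ *-cong u≈ v≈ ⟩
    (Π a * x + π * Π a * s) * (Π b * y + π * Π b * t)
      ≈⟨ solve 7 (λ P Q x y s t p → (P :* x :+ p :* P :* s) :* (Q :* y :+ p :* Q :* t)
                   := (P :* Q) :* (x :* y) :+ p :* (P :* Q) :* (x :* t :+ s :* y :+ p :* (s :* t)))
                 refl (Π a) (Π b) x y s t π ⟩
    (Π a * Π b) * (x * y) + π * (Π a * Π b) * (x * t + s * y + π * (s * t))
      ≈⟨ +-cong (*-congʳ (sym (Π-+ a b))) (*-congʳ (*-congˡ (sym (Π-+ a b)))) ⟩
    Π (a ℕ.+ b) * (x * y) + π * Π (a ℕ.+ b) * (x * t + s * y + π * (s * t)) ∎)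

  Congruent-π* : ∀ a {u v} → Congruent (Π a) u v → Congruent (Π (suc a)) (π * u) (π * v)
  Congruent-π* a (y , u≈) = y , trans (*-congˡ u≈) (trans (distribˡ _ _ _) (+-congˡ (sym (*-assoc _ _ _))))

  module Cancellation (π-regular : ∀ x → π * x ≈ 0# → x ≈ 0#) where
    open import Algebra.Properties.Ring ring using (x[y-z]≈xy-xz)
    open import Algebra.Properties.Group +-group using (x∙y⁻¹≈ε⇒x≈y; x≈y⇒x∙y⁻¹≈ε)

    π-cancel : ∀ {u v} → π * u ≈ π * v → u ≈ v
    π-cancel {u} {v} πu≈πv =
      x∙y⁻¹≈ε⇒x≈y u v (π-regular (u - v) (trans (x[y-z]≈xy-xz π u v) (x≈y⇒x∙y⁻¹≈ε πu≈πv)))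

    Π-cancel : ∀ q {u v} → Π q * u ≈ Π q * v → u ≈ v
    Π-cancel zero    e = trans (sym (*-identityˡ _)) (trans e (*-identityˡ _))
    Π-cancel (suc q) e = Π-cancel q (π-cancel (trans (sym (*-assoc _ _ _)) (trans e (*-assoc _ _ _))))

    leading-∣ : ∀ q {B X} → Congruent (Π (suc q)) B (Π q * X) → Π (suc q) ∣ᵣ B → π ∣ᵣ X
    leading-∣ q {B} {X} (y , B≈) (z , B≈') = z - y , (begin
      X                    ≈⟨ sym (+-identityʳ X) ⟩
      X + 0#               ≈⟨ +-congˡ (sym (-‿inverseʳ (π * y))) ⟩
      X + (π * y - π * y)  ≈⟨ solve 3 (λ x u v → x :+ (u :+ v) := (x :+ u) :+ v) refl X (π * y) (- (π * y)) ⟩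
      (X + π * y) - π * y  ≈⟨ +-congʳ (Π-cancel q shifted) ⟩
      π * z - π * y        ≈⟨ sym (x[y-z]≈xy-xz π z y) ⟩
      π * (z - y)          ∎)
      where
      shifted : Π q * (X + π * y) ≈ Π q * (π * z)
      shifted = begin
        Π q * (X + π * y)          ≈⟨ solve 4 (λ P x p y → P :* (x :+ p :* y) := P :* x :+ (p :* P) :* y)
                                            refl (Π q) X π y ⟩
        Π q * X + Π (suc q) * y    ≈⟨ sym B≈ ⟩
        B                          ≈⟨ B≈' ⟩
        Π (suc q) * z              ≈⟨ solve 3 (λ P p z → (p :* P) :* z := P :* (p :* z)) refl (Π q) π z ⟩
        Π q * (π * z)              ∎

+-≤-strict-or-equal : ∀ {a b x y} → a ≤ x → b ≤ y → a ℕ.+ b < x ℕ.+ y ⊎ (a ≡ x × b ≡ y)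
+-≤-strict-or-equal a≤x b≤y with ℕP.m≤n⇒m<n∨m≡n a≤x | ℕP.m≤n⇒m<n∨m≡n b≤y
... | inj₁ a<x | _        = inj₁ (ℕP.+-mono-<-≤ a<x b≤y)
... | inj₂ a≡x | inj₁ b<y = inj₁ (ℕP.+-mono-≤-< a≤x b<y)
... | inj₂ a≡x | inj₂ b≡y = inj₂ (a≡x , b≡y)

module Digits (N : ℕ) {{N≢0 : NonZero N}} where
  open ℕP
  open +-*-Solver using (solve; _:+_; _:*_; _:=_)

  digits-unique : ∀ {a b x y} → a < N → b < N → a ℕ.+ x ℕ.* N ≡ b ℕ.+ y ℕ.* N → a ≡ b × x ≡ y
  digits-unique {a} {b} {x} {y} a<N b<N e =
    a≡b , *-cancelʳ-≡ x y N (+-cancelˡ-≡ a _ _ (≡.trans e (≡.cong (ℕ._+ y ℕ.* N) (≡.sym a≡b))))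
    where
    open ≡.≡-Reasoning
    a≡b : a ≡ b
    a≡b = begin
      a                          ≡⟨ DM.m<n⇒m%n≡m a<N ⟨
      a DM.% N                   ≡⟨ DM.[m+kn]%n≡m%n a x N ⟨
      (a ℕ.+ x ℕ.* N) DM.% N     ≡⟨ ≡.cong (DM._% N) e ⟩
      (b ℕ.+ y ℕ.* N) DM.% N     ≡⟨ DM.[m+kn]%n≡m%n b y N ⟩
      b DM.% N                   ≡⟨ DM.m<n⇒m%n≡m b<N ⟩
      b                          ∎

  same-position : ∀ {a b : Fin N} s t → toℕ a ℕ.+ s ℕ.* N ≡ toℕ b ℕ.+ t ℕ.* N → a ≡ b × s ≡ t
  same-position {a} {b} s t e with digits-unique {x = s} {y = t} (FinP.toℕ<n a) (FinP.toℕ<n b) e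
  ... | a≡b , s≡t = FinP.toℕ-injective a≡b , s≡t

  decompose : ∀ w → Σ (Fin N) λ r → Σ ℕ λ q → toℕ r ℕ.+ q ℕ.* N ≡ w
  decompose w = fromℕ< (DM.m%n<n w N) , w DM./ N ,
    ≡.trans (≡.cong (ℕ._+ (w DM./ N) ℕ.* N) (FinP.toℕ-fromℕ< _)) (≡.sym (DM.m≡m%n+[m/n]*n w N))

  rearrange : ∀ i j a b → (i ℕ.+ a ℕ.* N) ℕ.+ (j ℕ.+ b ℕ.* N) ≡ (i ℕ.+ j) ℕ.+ (a ℕ.+ b) ℕ.* N
  rearrange i j a b =
    solve 5 (λ i j a b n → (i :+ a :* n) :+ (j :+ b :* n) := (i :+ j) :+ (a :+ b) :* n) ≡.refl i j a b N

  carry : ∀ {r₁ r₂ r s q} → r₁ < N → r₂ < N → r < N → (r₁ ℕ.+ r₂) ℕ.+ s ℕ.* N ≡ r ℕ.+ q ℕ.* N →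
          (r₁ ℕ.+ r₂ ≡ r × s ≡ q) ⊎ (r₁ ℕ.+ r₂ ≡ r ℕ.+ N × suc s ≡ q)
  carry {r₁} {r₂} {r} {s} {q} r₁<N r₂<N r<N e with r₁ ℕ.+ r₂ <? N
  ... | yes r₁+r₂<N = inj₁ (digits-unique r₁+r₂<N r<N e)
  ... | no  r₁+r₂≮N = inj₂ (≡.trans (≡.sym d+N≡r₁+r₂) (≡.cong (ℕ._+ N) (proj₁ d≡r×)) , proj₂ d≡r×)
    where
    d = (r₁ ℕ.+ r₂) ℕ.∸ N
    d+N≡r₁+r₂ : d ℕ.+ N ≡ r₁ ℕ.+ r₂
    d+N≡r₁+r₂ = m∸n+n≡m (≮⇒≥ r₁+r₂≮N)
    d<N : d < N
    d<N = +-cancelʳ-< N d N (≡.subst (_< N ℕ.+ N) (≡.sym d+N≡r₁+r₂) (+-mono-< r₁<N r₂<N))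
    d≡r× : d ≡ r × suc s ≡ q
    d≡r× = digits-unique d<N r<N
      (≡.trans (≡.sym (+-assoc d N _)) (≡.trans (≡.cong (ℕ._+ s ℕ.* N) d+N≡r₁+r₂) e))

  multiple-< : ∀ k Q s → k ℕ.+ Q ℕ.* N < k ℕ.+ s ℕ.* N → Q < s
  multiple-< k Q s lt = *-cancelʳ-< N Q s (+-cancelˡ-< k (Q ℕ.* N) (s ℕ.* N) lt)

  exponent-choice : ∀ K k t → t < N ℕ.* k →
                    Σ ℕ λ D → (K ℕ.+ D ≡ suc (N ℕ.* K) ℕ.* k) × (suc (N ℕ.* K) ℕ.* t < N ℕ.* D)
  exponent-choice K k t t<Nk = n ℕ.* k ℕ.∸ K , K+D≡nk , nt<ND
    where
    n = suc (N ℕ.* K)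
    nt+n≤Nnk : n ℕ.* t ℕ.+ n ≤ N ℕ.* (n ℕ.* k)
    nt+n≤Nnk = ≡.subst₂ _≤_ (≡.trans (*-suc n t) (+-comm n (n ℕ.* t)))
                 (solve 3 (λ a b c → a :* (b :* c) := b :* (a :* c)) ≡.refl n N k)
                 (*-monoʳ-≤ n t<Nk)
    nt+NK<Nnk : n ℕ.* t ℕ.+ N ℕ.* K < N ℕ.* (n ℕ.* k)
    nt+NK<Nnk = <-≤-trans (+-monoʳ-< (n ℕ.* t) (n<1+n (N ℕ.* K))) nt+n≤Nnk
    K<nk : K < n ℕ.* k
    K<nk = *-cancelˡ-< N K (n ℕ.* k) (≤-<-trans (m≤n+m (N ℕ.* K) (n ℕ.* t)) nt+NK<Nnk)
    K+D≡nk : K ℕ.+ (n ℕ.* k ℕ.∸ K) ≡ n ℕ.* k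
    K+D≡nk = m+[n∸m]≡n (<⇒≤ K<nk)
    nt<ND : n ℕ.* t < N ℕ.* (n ℕ.* k ℕ.∸ K)
    nt<ND = +-cancelˡ-< (N ℕ.* K) (n ℕ.* t) _
              (≡.subst₂ _<_ (+-comm (n ℕ.* t) (N ℕ.* K))
                (≡.trans (≡.cong (N ℕ.*_) (≡.sym K+D≡nk)) (*-distribˡ-+ N K _)) nt+NK<Nnk)

-- Giving the monomial πᵠ zⁱ (i < N)
-- the weight i + q·N, an element f lies in zʷ A_m exactly when every monomial of
-- weight below w is absent, i.e. πᵠ⁺¹ ∣ fᵢ whenever i + q·N < w.
module ZAdicFiltration {c ℓ : Level} (A : CommutativeRing c ℓ) (π : CommutativeRing.Carrier A)
                       (N : ℕ) {{N≢0 : NonZero N}} where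
  open CommutativeRing A
  open RingNotions A
  open Adjoin A π N
  open PowerDivisibility A π
  open Digits N
  open import Data.Bool using (if_then_else_)

  -- the contribution of fᵢ gⱼ to the coefficient of zᵏ in f g, so that
  -- (f *ₘ g) k is definitionally  sumFin λ i → sumFin λ j → term f g k i j
  term : Elt → Elt → Fin N → Fin N → Fin N → Carrier
  term f g k i j =
    if does (toℕ i ℕ.+ toℕ j ℕ.≟ toℕ k) then f i * g j
    else (if does (toℕ i ℕ.+ toℕ j ℕ.≟ toℕ k ℕ.+ N) then π * (f i * g j) else 0#)

  module _ (f g : Elt) (k i j : Fin N) where
    term-direct : toℕ i ℕ.+ toℕ j ≡ toℕ k → term f g k i j ≡ f i * g j
    term-direct e rewrite dec-true (toℕ i ℕ.+ toℕ j ℕ.≟ toℕ k) e = ≡.refl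

    term-carry : toℕ i ℕ.+ toℕ j ≢ toℕ k → toℕ i ℕ.+ toℕ j ≡ toℕ k ℕ.+ N →
                 term f g k i j ≡ π * (f i * g j)
    term-carry ne e rewrite dec-false (toℕ i ℕ.+ toℕ j ℕ.≟ toℕ k) ne
                          | dec-true (toℕ i ℕ.+ toℕ j ℕ.≟ toℕ k ℕ.+ N) e = ≡.refl

    term-none : toℕ i ℕ.+ toℕ j ≢ toℕ k → toℕ i ℕ.+ toℕ j ≢ toℕ k ℕ.+ N → term f g k i j ≡ 0#
    term-none ne ne' rewrite dec-false (toℕ i ℕ.+ toℕ j ℕ.≟ toℕ k) ne
                           | dec-false (toℕ i ℕ.+ toℕ j ℕ.≟ toℕ k ℕ.+ N) ne' = ≡.refl

  term-∣ : ∀ f g k Q i j α β → Π α ∣ᵣ f i → Π β ∣ᵣ g j →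
           toℕ k ℕ.+ Q ℕ.* N < (toℕ i ℕ.+ α ℕ.* N) ℕ.+ (toℕ j ℕ.+ β ℕ.* N) →
           Π (suc Q) ∣ᵣ term f g k i j
  term-∣ f g k Q i j α β Πα∣fᵢ Πβ∣gⱼ lt
    with toℕ i ℕ.+ toℕ j ℕ.≟ toℕ k | toℕ i ℕ.+ toℕ j ℕ.≟ toℕ k ℕ.+ N
  ... | yes direct | _ =
    ≡.subst (Π (suc Q) ∣ᵣ_) {y = term f g k i j} (≡.sym (term-direct f g k i j direct))
      (Π-∣-mono Q<α+β (Π-∣-* α β Πα∣fᵢ Πβ∣gⱼ))
    where
    weight : (toℕ i ℕ.+ α ℕ.* N) ℕ.+ (toℕ j ℕ.+ β ℕ.* N) ≡ toℕ k ℕ.+ (α ℕ.+ β) ℕ.* N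
    weight = ≡.trans (rearrange (toℕ i) (toℕ j) α β) (≡.cong (ℕ._+ (α ℕ.+ β) ℕ.* N) direct)
    Q<α+β : Q < α ℕ.+ β
    Q<α+β = multiple-< (toℕ k) Q (α ℕ.+ β) (≡.subst (toℕ k ℕ.+ Q ℕ.* N <_) weight lt)
  ... | no ¬direct | yes carried =
    ≡.subst (Π (suc Q) ∣ᵣ_) {y = term f g k i j} (≡.sym (term-carry f g k i j ¬direct carried))
      (Π-∣-mono Q<1+α+β (Π-∣-π* (α ℕ.+ β) (Π-∣-* α β Πα∣fᵢ Πβ∣gⱼ)))
    where
    weight : (toℕ i ℕ.+ α ℕ.* N) ℕ.+ (toℕ j ℕ.+ β ℕ.* N) ≡ toℕ k ℕ.+ suc (α ℕ.+ β) ℕ.* N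
    weight = ≡.trans (rearrange (toℕ i) (toℕ j) α β)
               (≡.trans (≡.cong (ℕ._+ (α ℕ.+ β) ℕ.* N) carried) (ℕP.+-assoc (toℕ k) N _))
    Q<1+α+β : Q < suc (α ℕ.+ β)
    Q<1+α+β = multiple-< (toℕ k) Q (suc (α ℕ.+ β)) (≡.subst (toℕ k ℕ.+ Q ℕ.* N <_) weight lt)
  ... | no ¬direct | no ¬carried =
    ≡.subst (Π (suc Q) ∣ᵣ_) {y = term f g k i j} (≡.sym (term-none f g k i j ¬direct ¬carried)) (∣-0 _)

  ZDivides : ℕ → Elt → Set (c ⊔ ℓ)
  ZDivides w f = ∀ i q → toℕ i ℕ.+ q ℕ.* N < w → Π (suc q) ∣ᵣ f i

  ZDivides-∣ : ∀ {w f} → ZDivides w f → ∀ i q → toℕ i ℕ.+ q ℕ.* N < w ℕ.+ N → Π q ∣ᵣ f i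
  ZDivides-∣ {w} {f} w∣f i zero    _  = Π⁰-∣ (f i)
  ZDivides-∣ {w} {f} w∣f i (suc q) lt =
    w∣f i q (ℕP.+-cancelʳ-< N (toℕ i ℕ.+ q ℕ.* N) w (≡.subst (_< w ℕ.+ N) shift lt))
    where
    shift : toℕ i ℕ.+ (N ℕ.+ q ℕ.* N) ≡ (toℕ i ℕ.+ q ℕ.* N) ℕ.+ N
    shift = ≡.trans (≡.cong (toℕ i ℕ.+_) (ℕP.+-comm N (q ℕ.* N))) (≡.sym (ℕP.+-assoc (toℕ i) (q ℕ.* N) N))

  ZDivides-exponent : ∀ {w f} → ZDivides w f → ∀ i → ∃ λ α → (w ≤ toℕ i ℕ.+ α ℕ.* N) × (Π α ∣ᵣ f i)
  ZDivides-exponent {w} {f} w∣f i with decompose w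
  ... | r , q , r+qN≡w with toℕ r ℕP.≤? toℕ i
  ...   | yes r≤i = q , ≡.subst (_≤ toℕ i ℕ.+ q ℕ.* N) r+qN≡w (ℕP.+-monoˡ-≤ (q ℕ.* N) r≤i) , Πq∣fᵢ q ≡.refl
    where
    Πq∣fᵢ : ∀ q' → q' ≡ q → Π q' ∣ᵣ f i
    Πq∣fᵢ zero     _      = Π⁰-∣ (f i)
    Πq∣fᵢ (suc q') ≡.refl = w∣f i q' (≡.subst (toℕ i ℕ.+ q' ℕ.* N <_)
      (≡.trans (ℕP.+-assoc (toℕ r) N (q' ℕ.* N)) r+qN≡w)
      (ℕP.+-monoˡ-< (q' ℕ.* N) (ℕP.≤-trans (FinP.toℕ<n i) (ℕP.m≤n+m N (toℕ r)))))
  ...   | no r≰i = suc q , w≤i+[1+q]N , w∣f i q (≡.subst (toℕ i ℕ.+ q ℕ.* N <_) r+qN≡w i+qN<r+qN)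
    where
    w≤i+[1+q]N : w ≤ toℕ i ℕ.+ suc q ℕ.* N
    w≤i+[1+q]N = ≡.subst₂ _≤_ r+qN≡w (ℕP.+-assoc (toℕ i) N (q ℕ.* N))
      (ℕP.+-monoˡ-≤ (q ℕ.* N) (ℕP.≤-trans (ℕP.<⇒≤ (FinP.toℕ<n r)) (ℕP.m≤n+m N (toℕ i))))
    i+qN<r+qN : toℕ i ℕ.+ q ℕ.* N < toℕ r ℕ.+ q ℕ.* N
    i+qN<r+qN = ℕP.+-monoˡ-< (q ℕ.* N) (ℕP.≰⇒> r≰i)

  ZDivides-* : ∀ {w₁ w₂ f g} → ZDivides w₁ f → ZDivides w₂ g → ZDivides (w₁ ℕ.+ w₂) (f *ₘ g)
  ZDivides-* {w₁} {w₂} {f} {g} w₁∣f w₂∣g k Q lt =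
    ∣-sumFin _ λ i → ∣-sumFin _ λ j → term-divisible i j
    where
    term-divisible : ∀ i j → Π (suc Q) ∣ᵣ term f g k i j
    term-divisible i j with ZDivides-exponent w₁∣f i | ZDivides-exponent w₂∣g j
    ... | α , w₁≤ , Πα∣fᵢ | β , w₂≤ , Πβ∣gⱼ =
      term-∣ f g k Q i j α β Πα∣fᵢ Πβ∣gⱼ (ℕP.<-≤-trans lt (ℕP.+-mono-≤ w₁≤ w₂≤))

  Leading : Elt → ℕ → Carrier → Set (c ⊔ ℓ)
  Leading f w x =
    ZDivides w f × (∀ r q → toℕ r ℕ.+ q ℕ.* N ≡ w → Congruent (Π (suc q)) (f r) (Π q * x))

  Leading-* : ∀ {f g w₁ w₂ x y} → Leading f w₁ x → Leading g w₂ y → Leading (f *ₘ g) (w₁ ℕ.+ w₂) (x * y)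
  Leading-* {f} {g} {w₁} {w₂} {x} {y} (w₁∣f , f-lead) (w₂∣g , g-lead) = ZDivides-* w₁∣f w₂∣g , product-lead
    where
    product-lead : ∀ r q → toℕ r ℕ.+ q ℕ.* N ≡ w₁ ℕ.+ w₂ →
                   Congruent (Π (suc q)) ((f *ₘ g) r) (Π q * (x * y))
    product-lead r q e with decompose w₁ | decompose w₂
    ... | r₁ , q₁ , e₁ | r₂ , q₂ , e₂ =
      Congruent-sumFin _ r₁ _ (λ i i≢r₁ → ∣-sumFin _ λ j → off-leading i j (inj₁ i≢r₁))
        (Congruent-sumFin _ r₂ _ (λ j j≢r₂ → off-leading r₁ j (inj₂ j≢r₂)) leading)
      where
      -- every pair (i , j) other than (r₁ , r₂) has weight above w₁ + w₂
      off-leading : ∀ i j → i ≢ r₁ ⊎ j ≢ r₂ → Π (suc q) ∣ᵣ term f g r i j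
      off-leading i j distinct with ZDivides-exponent w₁∣f i | ZDivides-exponent w₂∣g j
      ... | α , w₁≤ , Πα∣fᵢ | β , w₂≤ , Πβ∣gⱼ with +-≤-strict-or-equal w₁≤ w₂≤
      ...   | inj₁ lt = term-∣ f g r q i j α β Πα∣fᵢ Πβ∣gⱼ
                          (≡.subst (_< (toℕ i ℕ.+ α ℕ.* N) ℕ.+ (toℕ j ℕ.+ β ℕ.* N)) (≡.sym e) lt)
      ...   | inj₂ (eq₁ , eq₂) with distinct
      ...     | inj₁ i≢r₁ = ⊥-elim (i≢r₁ (proj₁ (same-position α q₁ (≡.trans (≡.sym eq₁) (≡.sym e₁)))))
      ...     | inj₂ j≢r₂ = ⊥-elim (j≢r₂ (proj₁ (same-position β q₂ (≡.trans (≡.sym eq₂) (≡.sym e₂)))))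

      weights : (toℕ r₁ ℕ.+ toℕ r₂) ℕ.+ (q₁ ℕ.+ q₂) ℕ.* N ≡ toℕ r ℕ.+ q ℕ.* N
      weights = ≡.trans (≡.sym (rearrange (toℕ r₁) (toℕ r₂) q₁ q₂)) (≡.trans (≡.cong₂ ℕ._+_ e₁ e₂) (≡.sym e))

      leading : Congruent (Π (suc q)) (term f g r r₁ r₂) (Π q * (x * y))
      leading with carry {s = q₁ ℕ.+ q₂} {q = q} (FinP.toℕ<n r₁) (FinP.toℕ<n r₂) (FinP.toℕ<n r) weights
      ... | inj₁ (direct , ≡.refl) =
        ≡.subst (λ t → Congruent _ t _) (≡.sym (term-direct f g r r₁ r₂ direct))
          (Congruent-* q₁ q₂ (f-lead r₁ q₁ e₁) (g-lead r₂ q₂ e₂))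
      ... | inj₂ (carried , ≡.refl) =
        ≡.subst (λ t → Congruent _ t _) (≡.sym (term-carry f g r r₁ r₂ not-direct carried))
          (Congruent-resp refl (sym (*-assoc _ _ _))
            (Congruent-π* (suc (q₁ ℕ.+ q₂)) (Congruent-* q₁ q₂ (f-lead r₁ q₁ e₁) (g-lead r₂ q₂ e₂))))
        where
        not-direct : toℕ r₁ ℕ.+ toℕ r₂ ≢ toℕ r
        not-direct direct = ℕ.≢-nonZero⁻¹ N (ℕP.+-cancelˡ-≡ (toℕ r) N 0
          (≡.trans (≡.sym carried) (≡.trans direct (≡.sym (ℕP.+-identityʳ (toℕ r))))))

  Leading-1 : Leading 1ₘ 0 1#
  Leading-1 = (λ i q ()) , one-lead
    where
    one-lead : ∀ r q → toℕ r ℕ.+ q ℕ.* N ≡ 0 → Congruent (Π (suc q)) (1ₘ r) (Π q * 1#)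
    one-lead r zero e rewrite dec-true (toℕ r ℕ.≟ 0) (ℕP.m+n≡0⇒m≡0 (toℕ r) e) =
      Congruent-≈ (sym (*-identityˡ 1#))
    one-lead r (suc q) e = ⊥-elim (ℕ.≢-nonZero⁻¹ N (ℕP.m+n≡0⇒m≡0 N (ℕP.m+n≡0⇒n≡0 (toℕ r) e)))

  powₘ : Elt → ℕ → Elt
  powₘ f zero    = 1ₘ
  powₘ f (suc n) = f *ₘ powₘ f n

  Leading-pow : ∀ {f w x} → Leading f w x → ∀ n → Leading (powₘ f n) (n ℕ.* w) (pow x n)
  Leading-pow lead zero    = Leading-1
  Leading-pow lead (suc n) = Leading-* lead (Leading-pow lead n)

module IntegralityCriterion {c ℓ : Level} (A : CommutativeRing c ℓ) (π : CommutativeRing.Carrier A)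
       (N : ℕ) {{N≢0 : NonZero N}}
       (π-regular : ∀ x → CommutativeRing._≈_ A (CommutativeRing._*_ A π x) (CommutativeRing.0# A) →
                          CommutativeRing._≈_ A x (CommutativeRing.0# A))
       (reduced : ∀ x n → RingNotions._∣ᵣ_ A π (RingNotions.pow A x n) → RingNotions._∣ᵣ_ A π x) where
  open CommutativeRing A
  open RingNotions A
  open Adjoin A π N
  open PowerDivisibility A π
  open Cancellation π-regular
  open Digits N
  open ZAdicFiltration A π N

  PowersDivisible : Elt → ℕ → ℕ → Set (c ⊔ ℓ)
  PowersDivisible b k K = ∀ n D → K ℕ.+ D ≡ n ℕ.* k → ∀ i → Π D ∣ᵣ powₘ b n i

  module _ {b : Elt} {k K : ℕ} (powers-divisible : PowersDivisible b k K) where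

    leading-coefficient-∣ : ∀ {t a} → t < N ℕ.* k → Leading b t a → π ∣ᵣ a
    leading-coefficient-∣ {t} {a} t<Nk lead with exponent-choice K k t t<Nk
    ... | D , K+D≡nk , nt<ND with decompose (suc (N ℕ.* K) ℕ.* t)
    ...   | r , q , r+qN≡nt =
      reduced a n (leading-∣ q (proj₂ (Leading-pow lead n) r q r+qN≡nt)
                               (Π-∣-mono q<D (powers-divisible n D K+D≡nk r)))
      where
      n = suc (N ℕ.* K)
      q<D : q < D
      q<D = ℕP.*-cancelʳ-< N q D (≡.subst (q ℕ.* N <_) (ℕP.*-comm N D)
              (ℕP.≤-<-trans (ℕP.m≤n+m (q ℕ.* N) (toℕ r)) (≡.subst (_< N ℕ.* D) (≡.sym r+qN≡nt) nt<ND)))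

    -- zᵗ ∣ b with t < N k improves to zᵗ⁺¹ ∣ b: only the coefficient at weight t changes
    ZDivides-step : ∀ {t} → t < N ℕ.* k → ZDivides t b → ZDivides (suc t) b
    ZDivides-step {t} t<Nk t∣b i q i+qN<1+t with ℕP.m≤n⇒m<n∨m≡n (ℕ.s≤s⁻¹ i+qN<1+t)
    ... | inj₁ i+qN<t = t∣b i q i+qN<t
    ... | inj₂ i+qN≡t
      with ZDivides-∣ t∣b i q (≡.subst (_< t ℕ.+ N) (≡.sym i+qN≡t) (ℕP.m<m+n t (ℕ.>-nonZero⁻¹ N)))
    ...   | a , bᵢ≈Πqa = Π-∣-suc q bᵢ≈Πqa (leading-coefficient-∣ t<Nk (t∣b , leading-term))
      where
      leading-term : ∀ r q' → toℕ r ℕ.+ q' ℕ.* N ≡ t → Congruent (Π (suc q')) (b r) (Π q' * a)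
      leading-term r q' e with same-position q' q (≡.trans e (≡.sym i+qN≡t))
      ... | ≡.refl , ≡.refl = Congruent-≈ bᵢ≈Πqa

    ZDivides-up-to : ∀ t → t ≤ N ℕ.* k → ZDivides t b
    ZDivides-up-to zero    _      i q ()
    ZDivides-up-to (suc t) 1+t≤Nk = ZDivides-step 1+t≤Nk (ZDivides-up-to t (ℕP.<⇒≤ 1+t≤Nk))

    Πᵏ-∣-coefficients : ∀ i → Π k ∣ᵣ b i
    Πᵏ-∣-coefficients i = ZDivides-∣ (ZDivides-up-to (N ℕ.* k) ℕP.≤-refl) i k
      (≡.subst (toℕ i ℕ.+ k ℕ.* N <_) (≡.trans (ℕP.+-comm N (k ℕ.* N)) (≡.cong (ℕ._+ N) (ℕP.*-comm k N)))
        (ℕP.+-monoˡ-< (k ℕ.* N) (FinP.toℕ<n i)))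

module AdjoinedRoot {c ℓ : Level} (A : CommutativeRing c ℓ) (π : CommutativeRing.Carrier A)
                    (N : ℕ) {{N≢0 : NonZero N}} where
  open CommutativeRing A
  open RingNotions A
  open Adjoin A π N
  open PowerDivisibility A π
  open ZAdicFiltration A π N using (powₘ)
  open import Relation.Binary.Reasoning.Setoid setoid

  torsionFree : (∀ x → π * x ≈ 0# → x ≈ 0#) → TorsionFreeₘ
  torsionFree π-regular x πx≈0 i = π-regular (x i) (πx≈0 i)

  separated : (∀ x → (∀ n → Π n ∣ᵣ x) → x ≈ 0#) → Separatedₘ
  separated sep x Πⁿ∣x i = sep (x i) (λ n → proj₁ (Πⁿ∣x n) i , proj₂ (Πⁿ∣x n) i)

  powₗ-≡ : ∀ b k n → powₗ (b , k) n ≡ (powₘ b n , n ℕ.* k)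
  powₗ-≡ b k zero    = ≡.refl
  powₗ-≡ b k (suc n) rewrite powₗ-≡ b k n = ≡.refl

  -- every element of the span of g₁, …, g_r has denominator π^(common-denominator g)
  common-denominator : ∀ {r} → (Fin r → Frac) → ℕ
  common-denominator {zero}  g = 0
  common-denominator {suc r} g = proj₂ (g fzero) ℕ.+ common-denominator (g ∘ fsuc)

  span-denominator : ∀ {r} (g : Fin r → Frac) (a : Fin r → Elt) →
                     proj₂ (sumₗ (λ i → ι (a i) *ₗ g i)) ≡ common-denominator g
  span-denominator {zero}  g a = ≡.refl
  span-denominator {suc r} g a = ≡.cong (proj₂ (g fzero) ℕ.+_) (span-denominator (g ∘ fsuc) (a ∘ fsuc))

  module _ (π-regular : ∀ x → π * x ≈ 0# → x ≈ 0#) where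
    open Cancellation π-regular

    numerator-∣ : ∀ {b c K D} → (b , K ℕ.+ D) ≈ₗ (c , K) → ∀ i → Π D ∣ᵣ b i
    numerator-∣ {b} {c} {K} {D} (j , e) i = c i , Π-cancel (j ℕ.+ K) (begin
      Π (j ℕ.+ K) * b i               ≈⟨ e i ⟩
      Π (j ℕ.+ (K ℕ.+ D)) * c i       ≈⟨ *-congʳ (reflexive (≡.cong Π (≡.sym (ℕP.+-assoc j K D)))) ⟩
      Π (j ℕ.+ K ℕ.+ D) * c i         ≈⟨ *-congʳ (Π-+ (j ℕ.+ K) D) ⟩
      (Π (j ℕ.+ K) * Π D) * c i       ≈⟨ *-assoc _ _ _ ⟩
      Π (j ℕ.+ K) * (Π D * c i)       ∎)

    integral⇒PowersDivisible : ∀ b k {r} (g : Fin r → Frac) → (∀ n → InSpan g (powₗ (b , k) n)) →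
      ∀ n D → common-denominator g ℕ.+ D ≡ n ℕ.* k → ∀ i → Π D ∣ᵣ powₘ b n i
    integral⇒PowersDivisible b k g in-span n D K+D≡nk with in-span n
    ... | a , xⁿ≈s = numerator-∣ (≡.subst₂ (λ d d' → (powₘ b n , d) ≈ₗ (proj₁ s , d'))
                                    (≡.sym K+D≡nk) (span-denominator g a)
                                    (≡.subst (_≈ₗ s) (powₗ-≡ b k n) xⁿ≈s))
      where
      s = sumₗ (λ i → ι (a i) *ₗ g i)

    totallyIntClosed : (∀ x n → π ∣ᵣ pow x n → π ∣ᵣ x) → TotallyIntClosedₘ
    totallyIntClosed reduced (b , k) (r , g , in-span) =
      (λ i → proj₁ (Πᵏ∣b i)) , 0 , λ i → trans (*-identityˡ (b i)) (proj₂ (Πᵏ∣b i))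
      where
      open IntegralityCriterion A π N π-regular reduced
      Πᵏ∣b : ∀ i → Π k ∣ᵣ b i
      Πᵏ∣b = Πᵏ-∣-coefficients (integral⇒PowersDivisible b k g in-span)

lemma3p5 : {r ℓr a ℓa : Level} (p : ℕ) → Prime p → ¬ (p ≡ 2) →
    (R : CommutativeRing r ℓr) →
    RingNotions.IsDVRWithUniformizer R p →
    RingNotions.PComplete R p →
    RingNotions.ResidueAlgClosed R p →
    (A : CommutativeRing a ℓa) →
    (f : CommutativeRing.Carrier R → CommutativeRing.Carrier A) →
    IsAlgebraMap R A f →
    RingNotions.PTorsionFree A p →
    RingNotions.PSeparated A p →
    RingNotions.ReducedModP A p →
    (m : ℕ) →
    Adjoin.TorsionFreeₘ A (RingNotions.nat A p) (p ^ m) ×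
    Adjoin.Separatedₘ A (RingNotions.nat A p) (p ^ m) ×
    Adjoin.TotallyIntClosedₘ A (RingNotions.nat A p) (p ^ m)
lemma3p5 p p-prime _ _ _ _ _ A _ _ torsion-free p-separated reduced m =
  torsionFree torsion-free , separated p-separated , totallyIntClosed torsion-free reduced
  where
  instance
    p^m≢0 : NonZero (p ^ m)
    p^m≢0 = ℕP.m^n≢0 p m {{prime⇒nonZero p-prime}}
  open AdjoinedRoot A (RingNotions.nat A p) (p ^ m)
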